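{- Let $T$ be a complete theory with monster model $\mathcal{U}$. A partitioned formula $\varphi(x;y)$ is $\mathrm{PM}$ in $T$ if and only if for every $n<\omega$ there are $(b_X)_{X\subseteq n}$ in $\mathcal{U}^y$ such that for every nonempty family $Z\subseteq\mathcal{P}(n)$, the partial type $\{\varphi(x;b_Y):Y\in Z\}$ is consistent if and only if $\bigcap Z\neq\emptyset$.
   Context: Identify $n<\omega$ with $\{0,\dots,n-1\}$. An $n$-pattern is $(\mathcal{C},\mathcal{I})$ with $\mathcal{C},\mathcal{I}\subseteq(\mathcal{P}(n)\times\mathcal{P}(n))\setminus\{(\emptyset,\emptyset)\}$. $\varphi$ exhibits it in $T$ if there are $b_0,\dots,b_{n-1}\in\mathcal{U}^y$ such that for each $(A^+,A^-)\in\mathcal{C}$ the type $\{\varphi(x;b_i):i\in A^+\}\cup\{\neg\varphi(x;b_j):j\in A^-\}$ is consistent and for each $(Z^+,Z^-)\in\mathcal{I}$ the analogous type is inconsistent. A pattern is reasonable if (i) for all $(Z^+,Z^-)\in\mathcal{I}$, $(Y^+,Y^-)\in\mathcal{C}$ there is $\epsilon\in\{+,-\}$ with $Z^\epsilon\not\subseteq Y^\epsilon$; (ii) $A^+\cap A^-=\emptyset$ for $(A^+,A^-)\in\mathcal{C}$; (iii) $Z^+\cap Z^-=\emptyset$ for $(Z^+,Z^-)\in\mathcal{I}$. It is positive if every condition $(X^+,X^-)$ has $X^-=\emptyset$. $\varphi$ is $\mathrm{PM}$ (positive maximal) in $T$ if for every $n<\omega$ it exhibits every reasonable positive $n$-pattern.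 -}

module Defs where

open import Data.Nat using (ℕ)
open import Data.Fin using (Fin)
open import Data.Fin.Subset using (Subset; _∈_; _⊆_; _∩_; Empty) renaming (⊥ to ∅)
open import Data.Bool using (Bool; true)
open import Data.Product using (Σ; ∃; _×_; _,_; proj₁; proj₂)
open import Data.Sum using (_⊎_)
open import Relation.Nullary using (¬_)
open import Relation.Binary.PropositionalEquality using (_≡_; _≢_)

Cond : ℕ → Set
Cond n = Subset n × Subset n

record Pattern (n : ℕ) : Set where
  field
    C : Cond n → Bool
    I : Cond n → Bool
    C-nontriv : ∀ p → C p ≡ true → p ≢ (∅ , ∅)
    I-nontriv : ∀ p → I p ≡ true → p ≢ (∅ , ∅)
open Pattern public

-- The model-theoretic data: φ(U) viewed as a relation between
-- realizations of x (type A) and parameters y (type B) in the monster model.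
module _ {A B : Set} (φ : A → B → Set) where

  Consistent : ∀ {n} → (Fin n → B) → Cond n → Set
  Consistent b (X⁺ , X⁻) =
    ∃ λ (a : A) → (∀ i → i ∈ X⁺ → φ a (b i)) × (∀ j → j ∈ X⁻ → ¬ φ a (b j))

  Exhibits : ∀ {n} → Pattern n → Set
  Exhibits {n} P = ∃ λ (b : Fin n → B) →
    (∀ p → C P p ≡ true → Consistent b p) ×
    (∀ p → I P p ≡ true → ¬ Consistent b p)

  Reasonable : ∀ {n} → Pattern n → Set
  Reasonable P =
    (∀ z y → I P z ≡ true → C P y ≡ true →
       (¬ (proj₁ z ⊆ proj₁ y)) ⊎ (¬ (proj₂ z ⊆ proj₂ y))) ×
    (∀ p → C P p ≡ true → Empty (proj₁ p ∩ proj₂ p)) ×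
    (∀ p → I P p ≡ true → Empty (proj₁ p ∩ proj₂ p))

  Positive : ∀ {n} → Pattern n → Set
  Positive P =
    (∀ p → C P p ≡ true → proj₂ p ≡ ∅) × (∀ p → I P p ≡ true → proj₂ p ≡ ∅)

  PM : Set
  PM = ∀ (n : ℕ) (P : Pattern n) → Reasonable P → Positive P → Exhibits P

  -- Right-hand side of Proposition 5.5.  A family Z ⊆ P(n) is given by its
  -- characteristic function; ⋂Z ≠ ∅ means some i lies in every Y ∈ Z.
  PowersetWitness : Set
  PowersetWitness = ∀ (n : ℕ) → ∃ λ (b : Subset n → B) →
    ∀ (Z : Subset n → Bool) → (∃ λ Y → Z Y ≡ true) →
      ((∃ λ (a : A) → ∀ Y → Z Y ≡ true → φ a (b Y))
         → ∃ λ (i : Fin n) → ∀ Y → Z Y ≡ true → i ∈ Y)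
      × ((∃ λ (i : Fin n) → ∀ Y → Z Y ≡ true → i ∈ Y)
         → ∃ λ (a : A) → ∀ Y → Z Y ≡ true → φ a (b Y))

{-# OPTIONS --safe #-}
module Submission where

-- Both sides say that instances of φ can be chosen so that a nonempty family of them is
-- consistent exactly when a prescribed downward closed family of index sets contains it.
-- PM ⇒ powerset: index by the 2ⁿ codes of subsets of n and take the sets of codes whose
-- subsets have a common point; being closed under subfamilies, this gives a reasonable
-- positive pattern, which PM exhibits.  Powerset ⇒ PM: for a reasonable positive pattern on n
-- let bᵢ be the powerset witness for Yᵢ, the set of codes of the C-sets containing i.  Then
-- {φ(x;bᵢ) : i ∈ S} is consistent iff S lies in some C-set, which holds for every C-set and,
-- by condition (i), fails for every I-set.

open import Defs
open import Data.Bool using (Bool; true)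
open import Data.Bool.Properties using () renaming (_≟_ to _≟ᵇ_)
open import Data.Empty using (⊥-elim)
open import Data.Fin using (Fin; zero; suc; combine; funToFin; finToFun)
open import Data.Fin.Properties using (any?; all?; 2↔Bool; funToFin-finToFin; finToFun-funToFin)
open import Data.Fin.Subset using (Subset; _∈_; _⊆_; _∩_; Nonempty; Empty) renaming (⊥ to ∅)
open import Data.Fin.Subset.Properties using (_∈?_; nonempty?; ∉⊥; Empty-unique; ⊆-refl; x∈p∩q⁻)
open import Data.Nat using (ℕ; _^_)
open import Data.Product using (∃; _×_; _,_; proj₁; proj₂)
import Data.Product.Function.Dependent.Propositional as Σ
open import Data.Sum using (_⊎_; [_,_]; inj₁)
open import Data.Vec using (tabulate; lookup)
open import Data.Vec.Properties
  using (≡-dec; tabulate-cong; tabulate∘lookup; lookup∘tabulate; []=⇒lookup; lookup⇒[]=)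
open import Function using (_∘_; _⇔_; mk⇔; Equivalence; Inverse)
open import Function.Related.Propositional using (module EquationalReasoning)
import Function.Properties.Equivalence as ⇔
open import Relation.Nullary using (¬_; Dec; yes; does)
open import Relation.Nullary.Decidable using (_×-dec_; _→-dec_; dec-true; decidable-stable)
open import Relation.Unary using (Decidable; ∁)
open import Relation.Unary.Properties using (∁?)
open import Relation.Binary.PropositionalEquality
  using (_≡_; _≢_; _≗_; refl; sym; trans; cong; cong₂; subst)

private variable
  m n : ℕ

does-true⇒ : ∀ {P : Set} (P? : Dec P) → does P? ≡ true → P
does-true⇒ (yes p) _ = p

≢∅⇒Nonempty : {X : Subset n} → X ≢ ∅ → Nonempty X
≢∅⇒Nonempty {X = X} X≢∅ = decidable-stable (nonempty? X) (X≢∅ ∘ Empty-unique)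

∈-tabulate : (f : Fin n → Bool) {k : Fin n} → k ∈ tabulate f ⇔ f k ≡ true
∈-tabulate f {k} = mk⇔
  (λ k∈ → trans (sym (lookup∘tabulate f k)) ([]=⇒lookup k∈))
  (λ fk → lookup⇒[]= k (tabulate f) (trans (lookup∘tabulate f k) fk))

funToFin-cong : {f g : Fin m → Fin n} → f ≗ g → funToFin f ≡ funToFin g
funToFin-cong {ℕ.zero}  f≗g = refl
funToFin-cong {ℕ.suc m} f≗g = cong₂ combine (f≗g zero) (funToFin-cong (f≗g ∘ suc))

encode : Subset n → Fin (2 ^ n)
encode X = funToFin (Inverse.from 2↔Bool ∘ lookup X)

decode : Fin (2 ^ n) → Subset n
decode k = tabulate (Inverse.to 2↔Bool ∘ finToFun k)

decode-encode : (X : Subset n) → decode (encode X) ≡ X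
decode-encode X = trans
  (tabulate-cong λ i → trans
    (cong (Inverse.to 2↔Bool) (finToFun-funToFin _ i))
    (Inverse.strictlyInverseˡ 2↔Bool (lookup X i)))
  (tabulate∘lookup X)

encode-decode : (k : Fin (2 ^ n)) → encode (decode {n} k) ≡ k
encode-decode {n} k = trans
  (funToFin-cong {n} λ i → trans
    (cong (Inverse.from 2↔Bool) (lookup∘tabulate (Inverse.to 2↔Bool ∘ finToFun {2} {n} k) i))
    (Inverse.strictlyInverseʳ 2↔Bool (finToFun k i)))
  (funToFin-finToFin {n} k)

CommonPoint : (Fin m → Subset n) → Subset m → Set
CommonPoint S W = ∃ λ i → ∀ k → k ∈ W → i ∈ S k

commonPoint? : (S : Fin m → Subset n) → Decidable (CommonPoint S)
commonPoint? S W = any? λ i → all? λ k → k ∈? W →-dec i ∈? S k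

commonPoint-antitone : (S : Fin m → Subset n) {W W′ : Subset m} →
                       W′ ⊆ W → CommonPoint S W → CommonPoint S W′
commonPoint-antitone S W′⊆W (i , i∈) = i , λ k k∈W′ → i∈ k (W′⊆W k∈W′)

PositiveFace : (Subset n → Set) → Cond n → Set
PositiveFace Q (W , V) = V ≡ ∅ × Nonempty W × Q W

positiveFace? : {Q : Subset n → Set} → Decidable Q → Decidable (PositiveFace Q)
positiveFace? Q? (W , V) = ≡-dec _≟ᵇ_ V ∅ ×-dec nonempty? W ×-dec Q? W

positiveFace-nontrivial : {Q : Subset n → Set} {p : Cond n} → PositiveFace Q p → p ≢ (∅ , ∅)
positiveFace-nontrivial (_ , (_ , i∈∅) , _) refl = ∉⊥ i∈∅

complexPattern : {Q : Subset n → Set} → Decidable Q → Pattern n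
complexPattern {Q = Q} Q? = record
  { C = does ∘ positiveFace? Q?
  ; I = does ∘ positiveFace? (∁? Q?)
  ; C-nontriv = λ p h → positiveFace-nontrivial {Q = Q} (does-true⇒ (positiveFace? Q? p) h)
  ; I-nontriv = λ p h → positiveFace-nontrivial {Q = ∁ Q} (does-true⇒ (positiveFace? (∁? Q?) p) h)
  }

ContainedInSomeC : Pattern n → Subset n → Set
ContainedInSomeC P Z = ∃ λ X → C P (X , ∅) ≡ true × Z ⊆ X

containing : {𝒞 : Subset n → Set} → Decidable 𝒞 → Fin n → Subset (2 ^ n)
containing 𝒞? i = tabulate λ k → does (𝒞? (decode k) ×-dec i ∈? decode k)

commonPoint-containing : {𝒞 : Subset n → Set} (𝒞? : Decidable 𝒞) {S : Subset n} → Nonempty S →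
                         CommonPoint (containing 𝒞?) S ⇔ ∃ λ X → 𝒞 X × S ⊆ X
commonPoint-containing {𝒞 = 𝒞} 𝒞? {S} (i₀ , i₀∈S) = mk⇔ to from
  where
  membership : ∀ k i → k ∈ containing 𝒞? i → 𝒞 (decode k) × i ∈ decode k
  membership k i k∈ =
    does-true⇒ (𝒞? (decode k) ×-dec i ∈? decode k) (Equivalence.to (∈-tabulate _) k∈)

  to : CommonPoint (containing 𝒞?) S → ∃ λ X → 𝒞 X × S ⊆ X
  to (k , k∈) =
    decode k , proj₁ (membership k i₀ (k∈ i₀ i₀∈S)) , λ i∈S → proj₂ (membership k _ (k∈ _ i∈S))

  from : (∃ λ X → 𝒞 X × S ⊆ X) → CommonPoint (containing 𝒞?) S
  from (X , 𝒞X , S⊆X) = encode X , λ i i∈S → Equivalence.from (∈-tabulate _)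
    (dec-true (𝒞? _ ×-dec i ∈? _)
      (subst (λ Y → 𝒞 Y × i ∈ Y) (sym (decode-encode X)) (𝒞X , S⊆X i∈S)))

image : (Fin n → Subset m) → Subset n → Subset m → Bool
image T S Y = does (any? λ i → i ∈? S ×-dec ≡-dec _≟ᵇ_ Y (T i))

image-all : (T : Fin n → Subset m) (S : Subset n) (P : Subset m → Set) →
            (∀ Y → image T S Y ≡ true → P Y) ⇔ (∀ i → i ∈ S → P (T i))
image-all T S P = mk⇔
  (λ h i i∈S → h (T i) (dec-true (any? _) (i , i∈S , refl)))
  λ h Y Y∈ → case (does-true⇒ (any? _) Y∈) h
  where
  case : ∀ {Y} → ∃ (λ i → i ∈ S × Y ≡ T i) → (∀ i → i ∈ S → P (T i)) → P Y
  case (i , i∈S , refl) h = h i i∈S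

preimage : (Subset n → Bool) → Subset (2 ^ n)
preimage Z = tabulate (Z ∘ decode)

encode∈preimage : (Z : Subset n → Bool) {Y : Subset n} → Z Y ≡ true → encode Y ∈ preimage Z
encode∈preimage Z {Y} zY =
  Equivalence.from (∈-tabulate _) (subst (λ X → Z X ≡ true) (sym (decode-encode Y)) zY)

preimage-all : (Z : Subset n → Bool) (P : Fin (2 ^ n) → Set) →
               (∀ k → k ∈ preimage Z → P k) ⇔ (∀ Y → Z Y ≡ true → P (encode Y))
preimage-all {n} Z P = mk⇔
  (λ h Y zY → h (encode Y) (encode∈preimage Z zY))
  (λ h k k∈ → subst P (encode-decode {n} k) (h (decode k) (Equivalence.to (∈-tabulate _) k∈)))

preimage-all-decoded : (Z : Subset n → Bool) (P : Subset n → Set) →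
                       (∀ k → k ∈ preimage Z → P (decode k)) ⇔ (∀ Y → Z Y ≡ true → P Y)
preimage-all-decoded {n} Z P = mk⇔
  (λ h Y zY → subst P (decode-encode Y) (h (encode Y) (encode∈preimage Z zY)))
  (λ h k k∈ → h (decode {n} k) (Equivalence.to (∈-tabulate _) k∈))

module _ {A B : Set} (φ : A → B → Set) where

  Consistent⁺ : (Fin n → B) → Subset n → Set
  Consistent⁺ b X = ∃ λ a → ∀ i → i ∈ X → φ a (b i)

  consistent⁺ : {b : Fin n → B} {X : Subset n} → Consistent⁺ b X → Consistent φ b (X , ∅)
  consistent⁺ (a , h) = a , h , λ _ j∈∅ → ⊥-elim (∉⊥ j∈∅)

  ExhibitedBy : Pattern n → (Fin n → B) → Set
  ExhibitedBy P b =
    (∀ p → C P p ≡ true → Consistent φ b p) × (∀ p → I P p ≡ true → ¬ Consistent φ b p)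

  -- The empty family is excluded: its consistency only says that A is inhabited.
  Realises : (Fin n → B) → (Subset n → Set) → Set
  Realises b Q = ∀ X → Nonempty X → Consistent⁺ b X ⇔ Q X

  IsPowersetWitness : (Subset n → B) → Set
  IsPowersetWitness {n} b = ∀ (Z : Subset n → Bool) → (∃ λ Y → Z Y ≡ true) →
      ((∃ λ (a : A) → ∀ Y → Z Y ≡ true → φ a (b Y))
         → ∃ λ (i : Fin n) → ∀ Y → Z Y ≡ true → i ∈ Y)
      × ((∃ λ (i : Fin n) → ∀ Y → Z Y ≡ true → i ∈ Y)
         → ∃ λ (a : A) → ∀ Y → Z Y ≡ true → φ a (b Y))

  positive⇒disjoint : {P : Pattern n} → Positive φ P →
                      (∀ p → C P p ≡ true → Empty (proj₁ p ∩ proj₂ p)) ×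
                      (∀ p → I P p ≡ true → Empty (proj₁ p ∩ proj₂ p))
  positive⇒disjoint (posC , posI) = disjoint posC , disjoint posI
    where
    disjoint : ∀ {R : Cond n → Set} → (∀ p → R p → proj₂ p ≡ ∅) →
               ∀ p → R p → Empty (proj₁ p ∩ proj₂ p)
    disjoint pos (W , V) h (i , i∈) with refl ← pos (W , V) h = ∉⊥ (proj₂ (x∈p∩q⁻ W ∅ i∈))

  complexPattern-positive : {Q : Subset n → Set} (Q? : Decidable Q) → Positive φ (complexPattern Q?)
  complexPattern-positive Q? =
      (λ p h → proj₁ (does-true⇒ (positiveFace? Q? p) h))
    , (λ p h → proj₁ (does-true⇒ (positiveFace? (∁? Q?) p) h))

  complexPattern-reasonable : {Q : Subset n → Set} → (∀ {W W′} → W′ ⊆ W → Q W → Q W′) →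
                              (Q? : Decidable Q) → Reasonable φ (complexPattern Q?)
  complexPattern-reasonable down Q? =
    separated , positive⇒disjoint {P = complexPattern Q?} (complexPattern-positive Q?)
    where
    separated : ∀ z y → I (complexPattern Q?) z ≡ true → C (complexPattern Q?) y ≡ true →
                ¬ (proj₁ z ⊆ proj₁ y) ⊎ ¬ (proj₂ z ⊆ proj₂ y)
    separated z y hz hy with (_ , _ , ¬Qz) ← does-true⇒ (positiveFace? (∁? Q?) z) hz
                            | (_ , _ , Qy) ← does-true⇒ (positiveFace? Q? y) hy
      = inj₁ λ z⊆y → ¬Qz (down z⊆y Qy)

  realises-complexPattern : {Q : Subset n → Set} (Q? : Decidable Q) {b : Fin n → B} →
                            ExhibitedBy (complexPattern Q?) b → Realises b Q
  realises-complexPattern Q? (cons , incons) X ne = mk⇔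
    (λ c → decidable-stable (Q? X) λ ¬QX →
       incons (X , ∅) (dec-true (positiveFace? (∁? Q?) (X , ∅)) (refl , ne , ¬QX)) (consistent⁺ c))
    (λ QX → let (a , h , _) = cons (X , ∅) (dec-true (positiveFace? Q? (X , ∅)) (refl , ne , QX)) in a , h)

  exhibitedBy-reasonable-positive : {P : Pattern n} {b : Fin n → B} →
    Reasonable φ P → Positive φ P → Realises b (ContainedInSomeC P) → ExhibitedBy P b
  exhibitedBy-reasonable-positive {P = P} {b} (separated , _) (posC , posI) realises = cons , incons
    where
    nonempty : ∀ {X} → (X , ∅) ≢ (∅ , ∅) → Nonempty X
    nonempty nt = ≢∅⇒Nonempty λ X≡∅ → nt (cong (_, ∅) X≡∅)

    cons : ∀ p → C P p ≡ true → Consistent φ b p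
    cons (X , V) h with refl ← posC (X , V) h =
      consistent⁺ (Equivalence.from (realises X (nonempty (C-nontriv P _ h))) (X , h , ⊆-refl))

    incons : ∀ p → I P p ≡ true → ¬ Consistent φ b p
    incons (Z , V) h (a , h⁺ , _) with refl ← posI (Z , V) h
      with (X , hX , Z⊆X) ← Equivalence.to (realises Z (nonempty (I-nontriv P _ h))) (a , h⁺)
      = [ (λ Z⊈X → Z⊈X Z⊆X) , (λ ∅⊈∅ → ∅⊈∅ ⊆-refl) ] (separated (Z , ∅) (X , ∅) h hX)

  open EquationalReasoning

  realises-commonPoint : {b : Subset m → B} → IsPowersetWitness b →
                         (T : Fin n → Subset m) → Realises (b ∘ T) (CommonPoint T)
  realises-commonPoint {b = b} isPW T S (i , i∈S) =
    let Z = image T S in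
    let (to , from) = isPW Z (T i , dec-true (any? _) (i , i∈S , refl)) in
    begin
      Consistent⁺ (b ∘ T) S                   ∼⟨ Σ.congˡ (⇔.sym (image-all T S (φ _ ∘ b))) ⟩
      (∃ λ a → ∀ Y → Z Y ≡ true → φ a (b Y))  ∼⟨ mk⇔ to from ⟩
      (∃ λ k → ∀ Y → Z Y ≡ true → k ∈ Y)      ∼⟨ Σ.congˡ (image-all T S (_ ∈_)) ⟩
      CommonPoint T S                         ∎

  realises⇒isPowersetWitness : ∀ {n} {b : Fin (2 ^ n) → B} →
    Realises b (CommonPoint (decode {n})) → IsPowersetWitness (b ∘ encode {n})
  realises⇒isPowersetWitness {n} {b} realises Z (Y , zY) =
    Equivalence.to chain , Equivalence.from chain
    where
    chain : (∃ λ a → ∀ Y → Z Y ≡ true → φ a (b (encode {n} Y))) ⇔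
            (∃ λ i → ∀ Y → Z Y ≡ true → i ∈ Y)
    chain = begin
      (∃ λ a → ∀ Y → Z Y ≡ true → φ a (b (encode {n} Y)))
        ∼⟨ Σ.congˡ (⇔.sym (preimage-all Z (φ _ ∘ b))) ⟩
      Consistent⁺ b (preimage Z)
        ∼⟨ realises (preimage Z) (encode Y , encode∈preimage Z zY) ⟩
      CommonPoint (decode {n}) (preimage Z)
        ∼⟨ Σ.congˡ (preimage-all-decoded Z (_ ∈_)) ⟩
      (∃ λ i → ∀ Y → Z Y ≡ true → i ∈ Y)
        ∎

  PM⇒PowersetWitness : PM φ → PowersetWitness φ
  PM⇒PowersetWitness pm n = witness (pm (2 ^ n) (complexPattern nerve?)
                                        (complexPattern-reasonable (commonPoint-antitone decode) nerve?)
                                        (complexPattern-positive nerve?))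
    where
    nerve? : Decidable (CommonPoint (decode {n}))
    nerve? = commonPoint? decode

    witness : Exhibits φ (complexPattern nerve?) → ∃ λ (b : Subset n → B) → IsPowersetWitness b
    witness (b , exhibited) =
      b ∘ encode , realises⇒isPowersetWitness (realises-complexPattern nerve? exhibited)

  PowersetWitness⇒PM : PowersetWitness φ → PM φ
  PowersetWitness⇒PM pw n P reasonable positive
    with b , isPW ← pw (2 ^ n)
    = b ∘ T , exhibitedBy-reasonable-positive {P = P} reasonable positive λ S ne →
        ⇔.trans (realises-commonPoint isPW T S ne) (commonPoint-containing C⁺? ne)
    where
    C⁺? : Decidable λ X → C P (X , ∅) ≡ true
    C⁺? X = C P (X , ∅) ≟ᵇ true

    T : Fin n → Subset (2 ^ n)
    T = containing C⁺?

proposition5p5 : ∀ {A B : Set} (φ : A → B → Set) →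
    (PM φ → PowersetWitness φ) × (PowersetWitness φ → PM φ)
proposition5p5 φ = PM⇒PowersetWitness φ , PowersetWitness⇒PM φ
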